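{- For every PDL program $\gamma$ and every PDL formula $\psi$, \[ [\gamma]\psi \equiv \bigvee\Big\{\textstyle\bigwedge X^{\ell}_{\gamma,\psi} \;\Big|\; \ell\in\mathit{TP}(\gamma)\Big\}. \]
   Context: PDL syntax $\phi ::= \bot \mid p \mid \lnot\phi \mid \phi\land\phi \mid [\alpha]\phi$, $\alpha ::= a \mid \tau? \mid \alpha\cup\beta \mid \alpha;\beta \mid \alpha^\ast$ with standard Kripke semantics; $\equiv$ is semantic equivalence (truth at the same states of all models); $\bigwedge X$ is the conjunction of a finite set $X$ ($\top$ if empty). For a list $\bar\delta=\delta_1\cdots\delta_n$ of programs, $\Box(\bar\delta,\phi)=[\delta_1]\cdots[\delta_n]\phi$, with $\Box(\varepsilon,\phi)=\phi$; juxtaposition denotes concatenation. Shallow tests: $\mathit{Tests}(a)=\emptyset$, $\mathit{Tests}(\tau?)=\{\tau\}$, $\mathit{Tests}(\alpha\cup\beta)=\mathit{Tests}(\alpha;\beta)=\mathit{Tests}(\alpha)\cup\mathit{Tests}(\beta)$, $\mathit{Tests}(\alpha^\ast)=\mathit{Tests}(\alpha)$. A test profile for $\alpha$ is a subset $\ell\subseteq\mathit{Tests}(\alpha)$; $\mathit{TP}(\alpha)$ is the set of all of them. For a set $\ell$ of formulas define sets of program lists: $P^\ell(a)=\{a\}$; $P^\ell(\tau?)=\{\varepsilon\}$ if $\tau\in\ell$ and $\emptyset$ otherwise; $P^\ell(\beta\cup\gamma)=P^\ell(\beta)\cup P^\ell(\gamma)$; $P^\ell(\beta;\gamma)=\{\bar\beta\gamma\mid\bar\beta\in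 P^\ell(\beta)\setminus\{\varepsilon\}\}\cup\{\bar\gamma\mid\bar\gamma\in P^\ell(\gamma),\ \varepsilon\in P^\ell(\beta)\}$; $P^\ell(\beta^\ast)=\{\varepsilon\}\cup\{\bar\beta\beta^\ast\mid\bar\beta\in P^\ell(\beta)\setminus\{\varepsilon\}\}$. Let $F^\ell(\alpha)=\{\lnot\tau\mid\tau\in\mathit{Tests}(\alpha),\tau\notin\ell\}$ and $X^\ell_{\alpha,\psi}=F^\ell(\alpha)\cup\{\Box(\bar\alpha,\psi)\mid\bar\alpha\in P^\ell(\alpha)\}$. -}

module Defs where

open import Data.Nat using (ℕ) renaming (_≡ᵇ_ to _≡ℕ_)
open import Data.Bool using (Bool; true; false; _∧_; if_then_else_)
open import Data.List using (List; []; _∷_; _++_; map; foldr; filter; concatMap)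
open import Data.Empty using (⊥)
open import Data.Product using (_×_; _,_; Σ)
open import Data.Sum using (_⊎_)
open import Relation.Binary.PropositionalEquality using (_≡_)
open import Relation.Nullary using (¬_; Dec; yes; no)

mutual
  data Form : Set where
    ⊥ᶠ   : Form
    var  : ℕ → Form
    ¬ᶠ_  : Form → Form
    _∧ᶠ_ : Form → Form → Form
    [_]_ : Prog → Form → Form

  data Prog : Set where
    act  : ℕ → Prog
    _¿   : Form → Prog
    _∪ᵖ_ : Prog → Prog → Prog
    _⨾_  : Prog → Prog → Prog
    _✶   : Prog → Prog

infixr 6 _∧ᶠ_
infix 7 ¬ᶠ_

⊤ᶠ : Form
⊤ᶠ = ¬ᶠ ⊥ᶠ

_∨ᶠ_ : Form → Form → Form
φ ∨ᶠ ψ = ¬ᶠ (¬ᶠ φ ∧ᶠ ¬ᶠ ψ)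

record Model : Set₁ where
  field
    W   : Set
    Rel : ℕ → W → W → Set
    Val : ℕ → W → Set
open Model public

data Star {W : Set} (R : W → W → Set) : W → W → Set where
  ε   : ∀ {w} → Star R w w
  _◅_ : ∀ {u v w} → R u v → Star R v w → Star R u w

mutual
  Sat : (M : Model) → W M → Form → Set
  Sat M w ⊥ᶠ        = ⊥
  Sat M w (var p)   = Val M p w
  Sat M w (¬ᶠ φ)    = ¬ (Sat M w φ)
  Sat M w (φ ∧ᶠ ψ)  = Sat M w φ × Sat M w ψ
  Sat M w ([ α ] φ) = ∀ v → Acc α M w v → Sat M v φ

  Acc : Prog → (M : Model) → W M → W M → Set
  Acc (act a) M u v   = Rel M a u v
  Acc (τ ¿) M u v     = (u ≡ v) × Sat M u τ
  Acc (α ∪ᵖ β) M u v  = Acc α M u v ⊎ Acc β M u v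
  Acc (α ⨾ β) M u v   = Σ (W M) λ x → Acc α M u x × Acc β M x v
  Acc (α ✶) M u v     = Star (Acc α M) u v

_≡ˢ_ : Form → Form → Set₁
φ ≡ˢ ψ = (M : Model) (w : W M) → (Sat M w φ → Sat M w ψ) × (Sat M w ψ → Sat M w φ)

mutual
  _==ᶠ_ : Form → Form → Bool
  ⊥ᶠ ==ᶠ ⊥ᶠ = true
  var p ==ᶠ var q = p ≡ℕ q
  (¬ᶠ φ) ==ᶠ (¬ᶠ ψ) = φ ==ᶠ ψ
  (φ₁ ∧ᶠ φ₂) ==ᶠ (ψ₁ ∧ᶠ ψ₂) = (φ₁ ==ᶠ ψ₁) ∧ (φ₂ ==ᶠ ψ₂)
  ([ α ] φ) ==ᶠ ([ β ] ψ) = (α ==ᵖ β) ∧ (φ ==ᶠ ψ)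
  _ ==ᶠ _ = false

  _==ᵖ_ : Prog → Prog → Bool
  act a ==ᵖ act b = a ≡ℕ b
  (φ ¿) ==ᵖ (ψ ¿) = φ ==ᶠ ψ
  (α₁ ∪ᵖ α₂) ==ᵖ (β₁ ∪ᵖ β₂) = (α₁ ==ᵖ β₁) ∧ (α₂ ==ᵖ β₂)
  (α₁ ⨾ α₂) ==ᵖ (β₁ ⨾ β₂) = (α₁ ==ᵖ β₁) ∧ (α₂ ==ᵖ β₂)
  (α ✶) ==ᵖ (β ✶) = α ==ᵖ β
  _ ==ᵖ _ = false

_∈ᵇ_ : Form → List Form → Bool
φ ∈ᵇ [] = false
φ ∈ᵇ (ψ ∷ xs) = if φ ==ᶠ ψ then true else φ ∈ᵇ xs

-- Finite sets are represented by lists (duplicates irrelevant).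

Tests : Prog → List Form
Tests (act a)  = []
Tests (τ ¿)    = τ ∷ []
Tests (α ∪ᵖ β) = Tests α ++ Tests β
Tests (α ⨾ β)  = Tests α ++ Tests β
Tests (α ✶)    = Tests α

-- all sub-lists of a list (= all subsets of the underlying finite set)
sublists : {A : Set} → List A → List (List A)
sublists [] = [] ∷ []
sublists (x ∷ xs) = let r = sublists xs in r ++ map (x ∷_) r

TP : Prog → List (List Form)
TP α = sublists (Tests α)

isEmpty : {A : Set} → List A → Bool
isEmpty [] = true
isEmpty (_ ∷ _) = false

nonEmpty : {A : Set} → List (List A) → List (List A)
nonEmpty [] = []
nonEmpty (xs ∷ xss) = if isEmpty xs then nonEmpty xss else xs ∷ nonEmpty xss

hasEmpty : {A : Set} → List (List A) → Bool
hasEmpty [] = false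
hasEmpty (xs ∷ xss) = if isEmpty xs then true else hasEmpty xss

P : List Form → Prog → List (List Prog)
P ℓ (act a)  = (act a ∷ []) ∷ []
P ℓ (τ ¿)    = if τ ∈ᵇ ℓ then [] ∷ [] else []
P ℓ (β ∪ᵖ γ) = P ℓ β ++ P ℓ γ
P ℓ (β ⨾ γ)  = map (λ bs → bs ++ (γ ∷ [])) (nonEmpty (P ℓ β))
               ++ (if hasEmpty (P ℓ β) then P ℓ γ else [])
P ℓ (β ✶)    = [] ∷ map (λ bs → bs ++ (β ✶ ∷ [])) (nonEmpty (P ℓ β))

Box : List Prog → Form → Form
Box δs φ = foldr [_]_ φ δs

F : List Form → Prog → List Form
F ℓ α = map ¬ᶠ_ (filter' (Tests α))
  where
    filter' : List Form → List Form
    filter' [] = []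
    filter' (τ ∷ ts) = if τ ∈ᵇ ℓ then filter' ts else τ ∷ filter' ts

X : List Form → Prog → Form → List Form
X ℓ α ψ = F ℓ α ++ map (λ as → Box as ψ) (P ℓ α)

⋀ : List Form → Form
⋀ = foldr _∧ᶠ_ ⊤ᶠ

⋁ : List Form → Form
⋁ = foldr _∨ᶠ_ ⊥ᶠ

{-# OPTIONS --safe #-}
module Submission where

-- A test profile ℓ guesses which shallow tests of γ succeed. The lists in P^ℓ(γ) consult tests
-- only before their first step, i.e. at the current state w; so whenever ℓ agrees with w on the
-- tests of γ, the γ-successors of w are exactly the states reachable along a list in P^ℓ(γ), and
-- [γ]ψ holds at w iff every Box(ᾱ, ψ) with ᾱ ∈ P^ℓ(γ) does. The conjuncts F^ℓ(γ) make every
-- disjunct that holds at w have a profile containing all tests true at w, which is the half of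
-- the agreement needed for ⇐; for ⇒ take ℓ to be the set of tests of γ true at w. Excluded
-- middle is needed to form that set and to extract a true disjunct from ⋁.

open import Defs
open import Data.List using (map)
open import Axiom.ExcludedMiddle using (ExcludedMiddle)
open import Level using (0ℓ)

open import Data.Bool using (true; false; if_then_else_; T)
open import Data.Bool.Properties using (T?; T-∧)
open import Data.Empty using (⊥-elim)
open import Data.List using (List; []; _∷_; _∷ʳ_; filter)
open import Data.List.Membership.Propositional using (_∈_)
open import Data.List.Membership.Propositional.Properties
  using (∈-map⁺; ∈-map⁻; ∈-++⁺ˡ; ∈-++⁺ʳ; ∈-++⁻; ∈-filter⁺; ∈-filter⁻)
open import Data.List.Relation.Unary.All as All using (All; []; _∷_)
open import Data.List.Relation.Unary.All.Properties using (++⁻ˡ; ++⁻ʳ)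
open import Data.List.Relation.Unary.Any using (here; there)
open import Data.Nat.Properties using (≡ᵇ⇒≡; ≡⇒≡ᵇ)
open import Data.Product using (_×_; _,_; proj₂; ∃-syntax)
open import Data.Sum using (_⊎_; inj₁; inj₂)
open import Data.Unit using (tt)
open import Function using (_∘_)
open import Function.Bundles using (Equivalence)
open import Relation.Binary.PropositionalEquality using (_≡_; refl; trans; cong; cong₂)
open import Relation.Nullary using (¬_; yes; no; ¬?)
open import Relation.Unary using (Decidable)

mutual
  ==ᶠ-refl : ∀ φ → T (φ ==ᶠ φ)
  ==ᶠ-refl ⊥ᶠ = tt
  ==ᶠ-refl (var p) = ≡⇒≡ᵇ p p refl
  ==ᶠ-refl (¬ᶠ φ) = ==ᶠ-refl φ
  ==ᶠ-refl (φ ∧ᶠ ψ) = Equivalence.from T-∧ (==ᶠ-refl φ , ==ᶠ-refl ψ)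
  ==ᶠ-refl ([ α ] φ) = Equivalence.from T-∧ (==ᵖ-refl α , ==ᶠ-refl φ)

  ==ᵖ-refl : ∀ α → T (α ==ᵖ α)
  ==ᵖ-refl (act a) = ≡⇒≡ᵇ a a refl
  ==ᵖ-refl (φ ¿) = ==ᶠ-refl φ
  ==ᵖ-refl (α ∪ᵖ β) = Equivalence.from T-∧ (==ᵖ-refl α , ==ᵖ-refl β)
  ==ᵖ-refl (α ⨾ β) = Equivalence.from T-∧ (==ᵖ-refl α , ==ᵖ-refl β)
  ==ᵖ-refl (α ✶) = ==ᵖ-refl α

mutual
  ==ᶠ⇒≡ : ∀ φ ψ → T (φ ==ᶠ ψ) → φ ≡ ψ
  ==ᶠ⇒≡ ⊥ᶠ ⊥ᶠ _ = refl
  ==ᶠ⇒≡ (var p) (var q) t = cong var (≡ᵇ⇒≡ p q t)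
  ==ᶠ⇒≡ (¬ᶠ φ) (¬ᶠ ψ) t = cong ¬ᶠ_ (==ᶠ⇒≡ φ ψ t)
  ==ᶠ⇒≡ (φ₁ ∧ᶠ φ₂) (ψ₁ ∧ᶠ ψ₂) t =
    let t₁ , t₂ = Equivalence.to T-∧ t in cong₂ _∧ᶠ_ (==ᶠ⇒≡ φ₁ ψ₁ t₁) (==ᶠ⇒≡ φ₂ ψ₂ t₂)
  ==ᶠ⇒≡ ([ α ] φ) ([ β ] ψ) t =
    let t₁ , t₂ = Equivalence.to T-∧ t in cong₂ [_]_ (==ᵖ⇒≡ α β t₁) (==ᶠ⇒≡ φ ψ t₂)

  ==ᵖ⇒≡ : ∀ α β → T (α ==ᵖ β) → α ≡ β
  ==ᵖ⇒≡ (act a) (act b) t = cong act (≡ᵇ⇒≡ a b t)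
  ==ᵖ⇒≡ (φ ¿) (ψ ¿) t = cong _¿ (==ᶠ⇒≡ φ ψ t)
  ==ᵖ⇒≡ (α₁ ∪ᵖ α₂) (β₁ ∪ᵖ β₂) t =
    let t₁ , t₂ = Equivalence.to T-∧ t in cong₂ _∪ᵖ_ (==ᵖ⇒≡ α₁ β₁ t₁) (==ᵖ⇒≡ α₂ β₂ t₂)
  ==ᵖ⇒≡ (α₁ ⨾ α₂) (β₁ ⨾ β₂) t =
    let t₁ , t₂ = Equivalence.to T-∧ t in cong₂ _⨾_ (==ᵖ⇒≡ α₁ β₁ t₁) (==ᵖ⇒≡ α₂ β₂ t₂)
  ==ᵖ⇒≡ (α ✶) (β ✶) t = cong _✶ (==ᵖ⇒≡ α β t)

∈ᵇ⇒∈ : ∀ {φ} xs → T (φ ∈ᵇ xs) → φ ∈ xs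
∈ᵇ⇒∈ {φ} (ψ ∷ xs) t with φ ==ᶠ ψ | ==ᶠ⇒≡ φ ψ
... | true  | φ≡ψ = here (φ≡ψ tt)
... | false | _   = there (∈ᵇ⇒∈ xs t)

∈⇒∈ᵇ : ∀ {φ xs} → φ ∈ xs → T (φ ∈ᵇ xs)
∈⇒∈ᵇ {φ} (here refl) with φ ==ᶠ φ | ==ᶠ-refl φ
... | true | _ = tt
∈⇒∈ᵇ {φ} {ψ ∷ _} (there φ∈xs) with φ ==ᶠ ψ
... | true  = tt
... | false = ∈⇒∈ᵇ φ∈xs

untested? : (ℓ : List Form) → Decidable (λ τ → ¬ T (τ ∈ᵇ ℓ))
untested? ℓ τ = ¬? (T? (τ ∈ᵇ ℓ))

untested-unique : ∀ ℓ (f : List Form → List Form) → f [] ≡ [] →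
                  (∀ τ ts → f (τ ∷ ts) ≡ (if τ ∈ᵇ ℓ then f ts else τ ∷ f ts)) →
                  ∀ ts → f ts ≡ filter (untested? ℓ) ts
untested-unique ℓ f f[] f∷ [] = f[]
untested-unique ℓ f f[] f∷ (τ ∷ ts) rewrite f∷ τ ts with τ ∈ᵇ ℓ
... | true  = untested-unique ℓ f f[] f∷ ts
... | false = cong (τ ∷_) (untested-unique ℓ f f[] f∷ ts)

-- The filter inside F is local to Defs and cannot be named; the meta filter′ is solved by
-- unification against it once Tests α is abstracted.
F≡ : ∀ ℓ α → F ℓ α ≡ map ¬ᶠ_ (filter (untested? ℓ) (Tests α))
F≡ ℓ α =
  trans F≡filter′ (cong (map ¬ᶠ_) (untested-unique ℓ filter′ refl (λ _ _ → refl) (Tests α)))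
  where
  filter′ : List Form → List Form
  filter′ = _

  F≡filter′ : F ℓ α ≡ map ¬ᶠ_ (filter′ (Tests α))
  F≡filter′ with Tests α
  ... | ts = refl

∈-F⁺ : ∀ ℓ γ {τ} → τ ∈ Tests γ → ¬ T (τ ∈ᵇ ℓ) → ¬ᶠ τ ∈ F ℓ γ
∈-F⁺ ℓ γ τ∈ τ∉ℓ rewrite F≡ ℓ γ = ∈-map⁺ ¬ᶠ_ (∈-filter⁺ (untested? ℓ) τ∈ τ∉ℓ)

∈-F⁻ : ∀ ℓ γ {φ} → φ ∈ F ℓ γ → ∃[ τ ] φ ≡ ¬ᶠ τ × τ ∈ Tests γ × ¬ T (τ ∈ᵇ ℓ)
∈-F⁻ ℓ γ φ∈ rewrite F≡ ℓ γ with ∈-map⁻ ¬ᶠ_ φ∈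
... | τ , τ∈ , refl = τ , refl , ∈-filter⁻ (untested? ℓ) τ∈

module _ {A : Set} where

  filter-∈-sublists : ∀ {p} {Q : A → Set p} (Q? : Decidable Q) xs → filter Q? xs ∈ sublists xs
  filter-∈-sublists Q? [] = here refl
  filter-∈-sublists Q? (x ∷ xs) with Q? x
  ... | yes _ = ∈-++⁺ʳ (sublists xs) (∈-map⁺ (x ∷_) (filter-∈-sublists Q? xs))
  ... | no  _ = ∈-++⁺ˡ (filter-∈-sublists Q? xs)

  ∈-if⁺ : ∀ {b} {x : A} {xs} → T b → x ∈ xs → x ∈ (if b then xs else [])
  ∈-if⁺ {true} _ x∈ = x∈

  ∈-if⁻ : ∀ b {x : A} {xs} → x ∈ (if b then xs else []) → T b × x ∈ xs
  ∈-if⁻ true x∈ = tt , x∈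

  ∈-nonEmpty⁺ : ∀ {x : A} {xs} xss → (x ∷ xs) ∈ xss → (x ∷ xs) ∈ nonEmpty xss
  ∈-nonEmpty⁺ (_ ∷ _) (here refl) = here refl
  ∈-nonEmpty⁺ ([] ∷ xss) (there m) = ∈-nonEmpty⁺ xss m
  ∈-nonEmpty⁺ ((_ ∷ _) ∷ xss) (there m) = there (∈-nonEmpty⁺ xss m)

  ∈-nonEmpty⁻ : ∀ {xs : List A} xss → xs ∈ nonEmpty xss → xs ∈ xss
  ∈-nonEmpty⁻ ([] ∷ xss) m = there (∈-nonEmpty⁻ xss m)
  ∈-nonEmpty⁻ ((_ ∷ _) ∷ xss) (here refl) = here refl
  ∈-nonEmpty⁻ ((_ ∷ _) ∷ xss) (there m) = there (∈-nonEmpty⁻ xss m)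

  []∈⇒hasEmpty : (xss : List (List A)) → [] ∈ xss → T (hasEmpty xss)
  []∈⇒hasEmpty ([] ∷ _) _ = tt
  []∈⇒hasEmpty ((_ ∷ _) ∷ xss) (there m) = []∈⇒hasEmpty xss m

  hasEmpty⇒[]∈ : (xss : List (List A)) → T (hasEmpty xss) → [] ∈ xss
  hasEmpty⇒[]∈ ([] ∷ _) _ = here refl
  hasEmpty⇒[]∈ ((_ ∷ _) ∷ xss) t = there (hasEmpty⇒[]∈ xss t)

module _ (ℓ : List Form) (β : Prog) where

  ∈-P-⨾⁺ˡ : ∀ {δ c cs} → (c ∷ cs) ∈ P ℓ β → (c ∷ cs) ∷ʳ δ ∈ P ℓ (β ⨾ δ)
  ∈-P-⨾⁺ˡ {δ} m = ∈-++⁺ˡ (∈-map⁺ (_∷ʳ δ) (∈-nonEmpty⁺ (P ℓ β) m))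

  ∈-P-⨾⁺ʳ : ∀ {δ δs} → [] ∈ P ℓ β → δs ∈ P ℓ δ → δs ∈ P ℓ (β ⨾ δ)
  ∈-P-⨾⁺ʳ []∈ m = ∈-++⁺ʳ _ (∈-if⁺ ([]∈⇒hasEmpty (P ℓ β) []∈) m)

  ∈-P-⨾⁻ : ∀ {δ δs} → δs ∈ P ℓ (β ⨾ δ) →
           (∃[ cs ] cs ∈ P ℓ β × δs ≡ cs ∷ʳ δ) ⊎ ([] ∈ P ℓ β × δs ∈ P ℓ δ)
  ∈-P-⨾⁻ {δ} m with ∈-++⁻ (map (_∷ʳ δ) (nonEmpty (P ℓ β))) m
  ... | inj₁ m′ =
    let cs , cs∈ , eq = ∈-map⁻ (_∷ʳ δ) m′ in inj₁ (cs , ∈-nonEmpty⁻ (P ℓ β) cs∈ , eq)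
  ... | inj₂ m′ =
    let t , δs∈ = ∈-if⁻ (hasEmpty (P ℓ β)) m′ in inj₂ (hasEmpty⇒[]∈ (P ℓ β) t , δs∈)

  ∈-P-✶⁺ : ∀ {c cs} → (c ∷ cs) ∈ P ℓ β → (c ∷ cs) ∷ʳ (β ✶) ∈ P ℓ (β ✶)
  ∈-P-✶⁺ m = there (∈-map⁺ (_∷ʳ (β ✶)) (∈-nonEmpty⁺ (P ℓ β) m))

  ∈-P-✶⁻ : ∀ {δs} → δs ∈ P ℓ (β ✶) → δs ≡ [] ⊎ ∃[ cs ] cs ∈ P ℓ β × δs ≡ cs ∷ʳ (β ✶)
  ∈-P-✶⁻ (here eq) = inj₁ eq
  ∈-P-✶⁻ (there m) =
    let cs , cs∈ , eq = ∈-map⁻ (_∷ʳ (β ✶)) m in inj₂ (cs , ∈-nonEmpty⁻ (P ℓ β) cs∈ , eq)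

module Kripke (M : Model) where

  Accs : List Prog → W M → W M → Set
  Accs [] u v = u ≡ v
  Accs (δ ∷ δs) u v = ∃[ x ] Acc δ M u x × Accs δs x v

  Accs-∷ʳ⁺ : ∀ δs {δ u x v} → Accs δs u x → Acc δ M x v → Accs (δs ∷ʳ δ) u v
  Accs-∷ʳ⁺ [] refl r = _ , r , refl
  Accs-∷ʳ⁺ (_ ∷ δs) (y , r , rs) r′ = y , r , Accs-∷ʳ⁺ δs rs r′

  Accs-∷ʳ⁻ : ∀ δs {δ u v} → Accs (δs ∷ʳ δ) u v → ∃[ x ] Accs δs u x × Acc δ M x v
  Accs-∷ʳ⁻ [] (x , r , refl) = _ , refl , r
  Accs-∷ʳ⁻ (_ ∷ δs) (y , r , rs) = let x , rs′ , r′ = Accs-∷ʳ⁻ δs rs in x , (y , r , rs′) , r′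

  Sat-Box⁺ : ∀ δs φ {u} → (∀ {v} → Accs δs u v → Sat M v φ) → Sat M u (Box δs φ)
  Sat-Box⁺ [] φ h = h refl
  Sat-Box⁺ (δ ∷ δs) φ h x r = Sat-Box⁺ δs φ (λ rs → h (x , r , rs))

  Sat-Box⁻ : ∀ δs φ {u v} → Sat M u (Box δs φ) → Accs δs u v → Sat M v φ
  Sat-Box⁻ [] φ s refl = s
  Sat-Box⁻ (δ ∷ δs) φ s (x , r , rs) = Sat-Box⁻ δs φ (s x r) rs

  Sat-⋀⁺ : ∀ xs {w} → (∀ {φ} → φ ∈ xs → Sat M w φ) → Sat M w (⋀ xs)
  Sat-⋀⁺ [] h = λ ()
  Sat-⋀⁺ (φ ∷ xs) h = h (here refl) , Sat-⋀⁺ xs (h ∘ there)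

  Sat-⋀⁻ : ∀ xs {w φ} → Sat M w (⋀ xs) → φ ∈ xs → Sat M w φ
  Sat-⋀⁻ (φ ∷ xs) (s , _) (here refl) = s
  Sat-⋀⁻ (φ ∷ xs) (_ , s) (there φ∈) = Sat-⋀⁻ xs s φ∈

  Sat-⋁⁺ : ∀ xs {w φ} → φ ∈ xs → Sat M w φ → Sat M w (⋁ xs)
  Sat-⋁⁺ (φ ∷ xs) (here refl) s (¬s , _) = ¬s s
  Sat-⋁⁺ (φ ∷ xs) (there φ∈) s (_ , ¬s) = ¬s (Sat-⋁⁺ xs φ∈ s)

  Sat-⋁⁻ : ExcludedMiddle 0ℓ → ∀ xs {w} → Sat M w (⋁ xs) → ∃[ φ ] φ ∈ xs × Sat M w φ
  Sat-⋁⁻ em (φ ∷ xs) {w} s with em {Sat M w φ} | em {Sat M w (⋁ xs)}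
  ... | yes sφ | _      = φ , here refl , sφ
  ... | no _   | yes s′ = let ψ , ψ∈ , sψ = Sat-⋁⁻ em xs s′ in ψ , there ψ∈ , sψ
  ... | no ¬sφ | no ¬s′ = ⊥-elim (s (¬sφ , ¬s′))

  module _ (ℓ : List Form) where

    Acc⇒Accs-P : ∀ γ {w v} → All (λ τ → Sat M w τ → T (τ ∈ᵇ ℓ)) (Tests γ) →
                 Acc γ M w v → ∃[ δs ] δs ∈ P ℓ γ × Accs δs w v
    Acc⇒Accs-P (act a) _ r = act a ∷ [] , here refl , (_ , r , refl)
    Acc⇒Accs-P (τ ¿) (h ∷ []) (refl , s) = [] , ∈-if⁺ (h s) (here refl) , refl
    Acc⇒Accs-P (β ∪ᵖ δ) h (inj₁ r) =
      let δs , δs∈ , rs = Acc⇒Accs-P β (++⁻ˡ (Tests β) h) r in δs , ∈-++⁺ˡ δs∈ , rs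
    Acc⇒Accs-P (β ∪ᵖ δ) h (inj₂ r) =
      let δs , δs∈ , rs = Acc⇒Accs-P δ (++⁻ʳ (Tests β) h) r in δs , ∈-++⁺ʳ (P ℓ β) δs∈ , rs
    Acc⇒Accs-P (β ⨾ δ) h (x , r , r′) with Acc⇒Accs-P β (++⁻ˡ (Tests β) h) r
    ... | c ∷ cs , cs∈ , rs = (c ∷ cs) ∷ʳ δ , ∈-P-⨾⁺ˡ ℓ β cs∈ , Accs-∷ʳ⁺ (c ∷ cs) rs r′
    ... | [] , []∈ , refl =
      let δs , δs∈ , rs = Acc⇒Accs-P δ (++⁻ʳ (Tests β) h) r′ in δs , ∈-P-⨾⁺ʳ ℓ β []∈ δs∈ , rs
    Acc⇒Accs-P (β ✶) h ε = [] , here refl , refl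
    Acc⇒Accs-P (β ✶) h (r ◅ r✶) with Acc⇒Accs-P β h r
    ... | c ∷ cs , cs∈ , rs = (c ∷ cs) ∷ʳ (β ✶) , ∈-P-✶⁺ ℓ β cs∈ , Accs-∷ʳ⁺ (c ∷ cs) rs r✶
    ... | [] , _ , refl = Acc⇒Accs-P (β ✶) h r✶

    Accs-P⇒Acc : ∀ γ {w v δs} → All (λ τ → T (τ ∈ᵇ ℓ) → Sat M w τ) (Tests γ) →
                 δs ∈ P ℓ γ → Accs δs w v → Acc γ M w v
    Accs-P⇒Acc (act a) _ (here refl) (_ , r , refl) = r
    Accs-P⇒Acc (τ ¿) (h ∷ []) δs∈ rs with ∈-if⁻ (τ ∈ᵇ ℓ) δs∈
    ... | t , here refl with rs
    ...   | refl = refl , h t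
    Accs-P⇒Acc (β ∪ᵖ δ) h δs∈ rs with ∈-++⁻ (P ℓ β) δs∈
    ... | inj₁ δs∈β = inj₁ (Accs-P⇒Acc β (++⁻ˡ (Tests β) h) δs∈β rs)
    ... | inj₂ δs∈δ = inj₂ (Accs-P⇒Acc δ (++⁻ʳ (Tests β) h) δs∈δ rs)
    Accs-P⇒Acc (β ⨾ δ) h δs∈ rs with ∈-P-⨾⁻ ℓ β {δ} δs∈
    ... | inj₁ (cs , cs∈ , refl) =
      let x , rs′ , r = Accs-∷ʳ⁻ cs rs in x , Accs-P⇒Acc β (++⁻ˡ (Tests β) h) cs∈ rs′ , r
    ... | inj₂ ([]∈ , δs∈δ) =
      _ , Accs-P⇒Acc β (++⁻ˡ (Tests β) h) []∈ refl , Accs-P⇒Acc δ (++⁻ʳ (Tests β) h) δs∈δ rs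
    Accs-P⇒Acc (β ✶) h δs∈ rs with ∈-P-✶⁻ ℓ β δs∈
    ... | inj₁ refl with rs
    ...   | refl = ε
    Accs-P⇒Acc (β ✶) h δs∈ rs | inj₂ (cs , cs∈ , refl) =
      let x , rs′ , r✶ = Accs-∷ʳ⁻ cs rs in Accs-P⇒Acc β h cs∈ rs′ ◅ r✶

  ⋀X⇒[] : ∀ ℓ γ ψ {w} → Sat M w (⋀ (X ℓ γ ψ)) → Sat M w ([ γ ] ψ)
  ⋀X⇒[] ℓ γ ψ {w} s v r =
    let δs , δs∈ , rs = Acc⇒Accs-P ℓ γ (All.tabulate true⇒selected) r
    in Sat-Box⁻ δs ψ (Sat-⋀⁻ (X ℓ γ ψ) s (∈-++⁺ʳ (F ℓ γ) (∈-map⁺ (λ δs → Box δs ψ) δs∈))) rs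
    where
    true⇒selected : ∀ {τ} → τ ∈ Tests γ → Sat M w τ → T (τ ∈ᵇ ℓ)
    true⇒selected {τ} τ∈ sτ with T? (τ ∈ᵇ ℓ)
    ... | yes t = t
    ... | no τ∉ℓ = ⊥-elim (Sat-⋀⁻ (X ℓ γ ψ) s (∈-++⁺ˡ (∈-F⁺ ℓ γ τ∈ τ∉ℓ)) sτ)

  []⇒⋀X : ∀ ℓ γ ψ {w} → (∀ {τ} → τ ∈ ℓ → Sat M w τ) →
          (∀ {τ} → τ ∈ Tests γ → Sat M w τ → τ ∈ ℓ) → Sat M w ([ γ ] ψ) → Sat M w (⋀ (X ℓ γ ψ))
  []⇒⋀X ℓ γ ψ {w} selected⇒true true⇒selected b = Sat-⋀⁺ (X ℓ γ ψ) sat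
    where
    sat : ∀ {φ} → φ ∈ X ℓ γ ψ → Sat M w φ
    sat φ∈ with ∈-++⁻ (F ℓ γ) φ∈
    ... | inj₁ φ∈F with ∈-F⁻ ℓ γ φ∈F
    ...   | τ , refl , τ∈ , τ∉ℓ = τ∉ℓ ∘ ∈⇒∈ᵇ ∘ true⇒selected τ∈
    sat φ∈ | inj₂ φ∈□ with ∈-map⁻ (λ δs → Box δs ψ) φ∈□
    ...   | δs , δs∈ , refl = Sat-Box⁺ δs ψ λ rs →
      b _ (Accs-P⇒Acc ℓ γ (All.tabulate λ _ → selected⇒true ∘ ∈ᵇ⇒∈ ℓ) δs∈ rs)

lemma3p14 : ExcludedMiddle 0ℓ → (γ : Prog) (ψ : Form) →
    ([ γ ] ψ) ≡ˢ ⋁ (map (λ ℓ → ⋀ (X ℓ γ ψ)) (TP γ))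
lemma3p14 em γ ψ M w = []⇒⋁ , ⋁⇒[]
  where
  open Kripke M

  disjunct : List Form → Form
  disjunct ℓ = ⋀ (X ℓ γ ψ)

  true? : Decidable (Sat M w)
  true? τ = em

  ℓw : List Form
  ℓw = filter true? (Tests γ)

  []⇒⋁ : Sat M w ([ γ ] ψ) → Sat M w (⋁ (map disjunct (TP γ)))
  []⇒⋁ b =
    Sat-⋁⁺ (map disjunct (TP γ)) (∈-map⁺ disjunct (filter-∈-sublists true? (Tests γ)))
           ([]⇒⋀X ℓw γ ψ (proj₂ ∘ ∈-filter⁻ true? {xs = Tests γ}) (∈-filter⁺ true?) b)

  ⋁⇒[] : Sat M w (⋁ (map disjunct (TP γ))) → Sat M w ([ γ ] ψ)
  ⋁⇒[] s with Sat-⋁⁻ em (map disjunct (TP γ)) s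
  ... | φ , φ∈ , sφ with ∈-map⁻ disjunct φ∈
  ...   | ℓ , _ , refl = ⋀X⇒[] ℓ γ ψ sφ
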